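{- Let $d\ge 0$ and let $\mathcal{F}$ be a graph class closed under taking subgraphs. If $\mathcal{F}$ is closed under weak oddomorphisms, then so is the class of all graphs $F$ with $\mathrm{ed}_{\mathcal{F}}(F)\le d$.
   Context: All graphs are finite, simple, undirected and loopless. The elimination distance $\mathrm{ed}_{\mathcal{F}}(F)$ of a graph $F$ to $\mathcal{F}$ is: $0$ if $F\in\mathcal{F}$; otherwise $1+\min_{v\in V(F)}\mathrm{ed}_{\mathcal{F}}(F-v)$ if $F$ is connected; and $\max_i\mathrm{ed}_{\mathcal{F}}(F_i)$ if $F$ is disconnected with connected components $F_i$. Let $\phi\colon F\to G$ be a homomorphism. A vertex $a\in V(F)$ is $\phi$-odd (resp. $\phi$-even) if $|N_F(a)\cap\phi^{ -1}(v)|$ is odd (resp. even) for every $v\in N_G(\phi(a))$. $\phi$ is an oddomorphism if every vertex of $F$ is $\phi$-odd or $\phi$-even and every fibre $\phi^{ -1}(v)$, $v\in V(G)$, contains an odd number of $\phi$-odd vertices. $\phi$ is a weak oddomorphism if its restriction to some subgraph $F'$ of $F$ is an oddomorphism $F'\to G$. A class $\mathcal{C}$ is closed under weak oddomorphisms if $F\in\mathcal{C}$ and a weak oddomorphism $F\to G$ imply $G\in\mathcal{C}$. -}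

module Defs where

open import Data.Nat using (ℕ; zero; suc; _+_; _<_; _%_)
open import Data.Fin using (Fin; zero; suc; punchIn)
open import Data.Bool using (Bool; true; false; if_then_else_)
open import Data.Product using (Σ; ∃; ∃-syntax; _×_; _,_)
open import Data.Sum using (_⊎_)
open import Relation.Nullary using (¬_; Dec; does)
open import Relation.Binary.PropositionalEquality using (_≡_; _≢_; refl)
open import Function.Definitions using (Injective)

record Graph : Set where
  field
    n      : ℕ
    adj    : Fin n → Fin n → Bool
    sym    : ∀ i j → adj i j ≡ adj j i
    irrefl : ∀ i → adj i i ≡ false

open Graph public

V : Graph → Set
V F = Fin (n F)

Edge : (F : Graph) → V F → V F → Set
Edge F a b = adj F a b ≡ true

Class : Set₁
Class = Graph → Set

IsHom : (F G : Graph) → (V F → V G) → Set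
IsHom F G φ = ∀ a b → Edge F a b → Edge G (φ a) (φ b)

record SubgraphEmb (F G : Graph) : Set where
  field
    emb     : V F → V G
    inj     : Injective _≡_ _≡_ emb
    hom     : IsHom F G emb

SubgraphClosed : Class → Set
SubgraphClosed C = ∀ F G → SubgraphEmb F G → C G → C F

countF : (m : ℕ) → (Fin m → Bool) → ℕ
countF zero    p = 0
countF (suc m) p = (if p zero then 1 else 0) + countF m (λ i → p (suc i))

Odd : ℕ → Set
Odd k = k % 2 ≡ 1

Even : ℕ → Set
Even k = k % 2 ≡ 0

module _ (F G : Graph) (φ : V F → V G) where

  fibreEq : V G → V G → Bool
  fibreEq u v = does (Data.Fin._≟_ u v)

  nbrsIn : V F → V G → ℕ
  nbrsIn a v = countF (n F) (λ b → if adj F a b then fibreEq (φ b) v else false)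

  IsOddVertex : V F → Set
  IsOddVertex a = ∀ v → Edge G (φ a) v → Odd (nbrsIn a v)

  IsEvenVertex : V F → Set
  IsEvenVertex a = ∀ v → Edge G (φ a) v → Even (nbrsIn a v)

  record IsOddomorphism : Set where
    field
      hom        : IsHom F G φ
      oddOrEven  : ∀ a → IsOddVertex a ⊎ IsEvenVertex a
      -- decision procedure for φ-oddness, used only to count the φ-odd
      -- vertices in each fibre (any decision procedure gives the same count)
      oddDec     : ∀ a → Dec (IsOddVertex a)
      fibreOdd   : ∀ v → Odd (countF (n F)
                      (λ a → if fibreEq (φ a) v then does (oddDec a) else false))

record IsWeakOddomorphism (F G : Graph) (φ : V F → V G) : Set where
  field
    hom : IsHom F G φ
    F'  : Graph
    ι   : SubgraphEmb F' F
    odd : IsOddomorphism F' G (λ x → φ (SubgraphEmb.emb ι x))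

ClosedUnderWeakOddomorphisms : Class → Set
ClosedUnderWeakOddomorphisms C =
  ∀ F G (φ : V F → V G) → C F → IsWeakOddomorphism F G φ → C G

data Reach (F : Graph) : V F → V F → Set where
  here : ∀ {a} → Reach F a a
  step : ∀ {a b c} → Edge F a b → Reach F b c → Reach F a c

Connected : Graph → Set
Connected F = (0 < n F) × (∀ a b → Reach F a b)

record IsComponent (F : Graph) (v : V F) (H : Graph) : Set where
  field
    emb      : V H → V F
    inj      : Injective _≡_ _≡_ emb
    induced  : ∀ i j → adj H i j ≡ adj F (emb i) (emb j)
    inComp   : ∀ i → Reach F v (emb i)
    onto     : ∀ u → Reach F v u → ∃[ i ] emb i ≡ u

private
  deleteRaw : (m : ℕ) (a : Fin m → Fin m → Bool)
              → (∀ i j → a i j ≡ a j i) → (∀ i → a i i ≡ false)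
              → Fin m → Graph
  deleteRaw (suc m) a s r v = record
    { n = m
    ; adj = λ i j → a (punchIn v i) (punchIn v j)
    ; sym = λ i j → s (punchIn v i) (punchIn v j)
    ; irrefl = λ i → r (punchIn v i)
    }

_─_ : (F : Graph) → V F → Graph
F ─ v = deleteRaw (n F) (adj F) (sym F) (irrefl F) v

-- Elimination distance: EdLe C d F  means  ed_C(F) ≤ d.

data EdLe (C : Class) : ℕ → Graph → Set where
  inClass      : ∀ {d F} → C F → EdLe C d F
  connected    : ∀ {d F} → Connected F → (v : V F) → EdLe C d (F ─ v)
                 → EdLe C (suc d) F
  disconnected : ∀ {d F} → ¬ Connected F
                 → (∀ v H → IsComponent F v H → EdLe C d H)
                 → EdLe C d F

-- If φ : F → G is an oddomorphism and F - v has elimination distance at most d,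
-- then deleting the fibre over φ v, together with the even vertices whose image
-- sees only φ v, leaves an oddomorphism onto G - φ v from a subgraph of F - v.
-- If G is disconnected, the preimage of each component of G maps oddomorphically
-- onto it.  If G is connected, the parity of the number of odd vertices in a
-- fibre is the same for all fibres, also after restricting φ to an
-- adjacency-closed part of F (double count the edges between adjacent fibres);
-- so either a component of F or the rest of F is again oddomorphic to G, and
-- iterating yields a connected subgraph of F oddomorphic to G.  As the
-- elimination distance to a subgraph-closed class does not increase on
-- subgraphs, induction on d gives the theorem.

module Submission where

open import Algebra.Bundles using (CommutativeRing)
open import Data.Bool using (Bool; true; false; if_then_else_; _∧_; not; _xor_)
import Data.Bool.Properties as Bool
open import Data.Empty using (⊥; ⊥-elim)
open import Data.Fin using (Fin; zero; suc; fromℕ<; punchIn; punchOut; _≟_)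
open import Data.Fin.Properties
  using (any?; all?; ¬Fin0; toℕ<n; punchIn-injective; punchInᵢ≢i; punchIn-punchOut)
  renaming (suc-injective to Fin-suc-injective)
open import Data.Nat using (ℕ; zero; suc; _+_; _<_; _≤_; z≤n; s≤s; _<?_)
open import Data.Nat.Induction using (<-wellFounded)
open import Data.Nat.Properties using (≤-trans; n≤1+n; +-suc; suc-injective; m<n⇒0<n)
open import Data.Product using (Σ-syntax; ∃-syntax; _×_; _,_; proj₁; proj₂)
open import Data.Sum using (_⊎_; inj₁; inj₂; [_,_]′)
import Data.Sum as Sum
open import Function using (_∘_; id)
open import Function.Bundles using (mk⇔)
open import Function.Definitions using (Injective)
open import Induction.WellFounded using (Acc; acc)
open import Relation.Binary.PropositionalEquality
  using (_≡_; _≢_; refl; sym; trans; cong; cong₂; subst; subst₂; module ≡-Reasoning)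
open import Relation.Nullary using (Dec; does; yes; no)
open import Relation.Nullary.Decidable
  using (dec-true; does-⇔; map′; _×-dec_; _⊎-dec_; ¬?)

open import Defs hiding (sym)

open CommutativeRing Bool.xor-∧-commutativeRing using (+-commutativeMonoid)
open import Algebra.Properties.CommutativeMonoid.Sum +-commutativeMonoid
  using (∑-comm; sum-cong-≗; sum-replicate-zero)
  renaming (sum to xorSum)

does-true⇒ : ∀ {A : Set} (a? : Dec A) → does a? ≡ true → A
does-true⇒ (yes a) _ = a

if-true : ∀ {b c} → (if b then c else false) ≡ true → b ≡ true × c ≡ true
if-true {true} c≡true = refl , c≡true

∧-implied : ∀ {a b} → (b ≡ true → a ≡ true) → a ∧ b ≡ b
∧-implied {true}  _   = refl
∧-implied {false} {true}  b⇒a = b⇒a refl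
∧-implied {false} {false} _   = refl

if-if-swap : ∀ x y z →
  (if x then (if y then z else false) else false) ≡
  (if z then (if y then x else false) else false)
if-if-swap true  true  true  = refl
if-if-swap true  true  false = refl
if-if-swap true  false true  = refl
if-if-swap true  false false = refl
if-if-swap false true  true  = refl
if-if-swap false true  false = refl
if-if-swap false false true  = refl
if-if-swap false false false = refl

countF-cong : ∀ m {p q : Fin m → Bool} → (∀ i → p i ≡ q i) → countF m p ≡ countF m q
countF-cong zero    p≗q = refl
countF-cong (suc m) p≗q =
  cong₂ _+_ (cong (λ b → if b then 1 else 0) (p≗q zero)) (countF-cong m (p≗q ∘ suc))

countF-≤ : ∀ m (p : Fin m → Bool) → countF m p ≤ m
countF-≤ zero    p = z≤n
countF-≤ (suc m) p with p zero
... | true  = s≤s (countF-≤ m (p ∘ suc))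
... | false = ≤-trans (countF-≤ m (p ∘ suc)) (n≤1+n m)

countF-< : ∀ m (p : Fin m → Bool) i → p i ≡ false → countF m p < m
countF-< (suc m) p zero    pi≡false rewrite pi≡false = s≤s (countF-≤ m (p ∘ suc))
countF-< (suc m) p (suc i) pi≡false with p zero
... | true  = s≤s (countF-< m (p ∘ suc) i pi≡false)
... | false = ≤-trans (countF-< m (p ∘ suc) i pi≡false) (n≤1+n m)

countF-split : ∀ m (p q : Fin m → Bool) →
  countF m q ≡ countF m (λ i → p i ∧ q i) + countF m (λ i → not (p i) ∧ q i)
countF-split zero    p q = refl
countF-split (suc m) p q with p zero | q zero
... | true  | true  = cong suc (countF-split m (p ∘ suc) (q ∘ suc))
... | true  | false = countF-split m (p ∘ suc) (q ∘ suc)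
... | false | true  = trans (cong suc (countF-split m (p ∘ suc) (q ∘ suc))) (sym (+-suc _ _))
... | false | false = countF-split m (p ∘ suc) (q ∘ suc)

odd-countF⇒Fin : ∀ m (p : Fin m → Bool) → Odd (countF m p) → Fin m
odd-countF⇒Fin (suc m) p _ = zero

select : ∀ m (p : Fin m → Bool) → Fin (countF m p) → Fin m
select (suc m) p i with p zero
select (suc m) p zero    | true  = zero
select (suc m) p (suc i) | true  = suc (select m (p ∘ suc) i)
select (suc m) p i       | false = suc (select m (p ∘ suc) i)

select-true : ∀ m (p : Fin m → Bool) i → p (select m p i) ≡ true
select-true (suc m) p i with p zero in p0
select-true (suc m) p zero    | true  = p0
select-true (suc m) p (suc i) | true  = select-true m (p ∘ suc) i
select-true (suc m) p i       | false = select-true m (p ∘ suc) i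

select-injective : ∀ m (p : Fin m → Bool) → Injective _≡_ _≡_ (select m p)
select-injective (suc m) p {i} {j} eq with p zero
select-injective (suc m) p {zero}  {zero}  eq | true  = refl
select-injective (suc m) p {suc i} {suc j} eq | true  =
  cong suc (select-injective m (p ∘ suc) (Fin-suc-injective eq))
select-injective (suc m) p {i}     {j}     eq | false =
  select-injective m (p ∘ suc) (Fin-suc-injective eq)

select-onto : ∀ m (p : Fin m → Bool) a → p a ≡ true → ∃[ i ] select m p i ≡ a
select-onto (suc m) p a pa with p zero in p0
select-onto (suc m) p zero    pa | true  = zero , refl
select-onto (suc m) p (suc a) pa | true  with select-onto m (p ∘ suc) a pa
... | i , refl = suc i , refl
select-onto (suc m) p zero    pa | false with () ← trans (sym pa) p0
select-onto (suc m) p (suc a) pa | false with select-onto m (p ∘ suc) a pa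
... | i , refl = i , refl

countF-select : ∀ m (p q : Fin m → Bool) →
  countF (countF m p) (q ∘ select m p) ≡ countF m (λ i → p i ∧ q i)
countF-select zero    p q = refl
countF-select (suc m) p q with p zero
... | true  = cong (_ +_) (countF-select m (p ∘ suc) (q ∘ suc))
... | false = countF-select m (p ∘ suc) (q ∘ suc)

parity : ℕ → Bool
parity zero          = false
parity (suc zero)    = true
parity (suc (suc k)) = parity k

parity-odd : ∀ k → Odd k → parity k ≡ true
parity-odd (suc zero)    _ = refl
parity-odd (suc (suc k)) o = parity-odd k o

parity-even : ∀ k → Even k → parity k ≡ false
parity-even zero          _ = refl
parity-even (suc (suc k)) e = parity-even k e

parity⇒odd : ∀ k → parity k ≡ true → Odd k
parity⇒odd (suc zero)    _ = refl
parity⇒odd (suc (suc k)) p = parity⇒odd k p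

odd-even : ∀ {k} → Odd k → Even k → ⊥
odd-even o e with () ← trans (sym o) e

parity-suc : ∀ k → parity (suc k) ≡ not (parity k)
parity-suc zero          = refl
parity-suc (suc zero)    = refl
parity-suc (suc (suc k)) = parity-suc k

parity-+ : ∀ k l → parity (k + l) ≡ parity k xor parity l
parity-+ zero    l = refl
parity-+ (suc k) l = begin
  parity (suc (k + l))               ≡⟨ parity-suc (k + l) ⟩
  not (parity (k + l))               ≡⟨ cong not (parity-+ k l) ⟩
  not (parity k xor parity l)        ≡⟨ Bool.not-distribˡ-xor (parity k) (parity l) ⟩
  not (parity k) xor parity l        ≡⟨ cong (_xor parity l) (parity-suc k) ⟨
  parity (suc k) xor parity l        ∎
  where open ≡-Reasoning

parity-countF : ∀ m (p : Fin m → Bool) → parity (countF m p) ≡ xorSum p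
parity-countF zero    p = refl
parity-countF (suc m) p =
  trans (parity-+ (if p zero then 1 else 0) (countF m (p ∘ suc)))
        (cong₂ _xor_ (parity-indicator (p zero)) (parity-countF m (p ∘ suc)))
  where
    parity-indicator : ∀ b → parity (if b then 1 else 0) ≡ b
    parity-indicator true  = refl
    parity-indicator false = refl

edge-sym : ∀ F {a b} → Edge F a b → Edge F b a
edge-sym F {a} {b} e = trans (Graph.sym F b a) e

reach-snoc : ∀ {F a b c} → Reach F a b → Edge F b c → Reach F a c
reach-snoc here         e = step e here
reach-snoc (step e′ r) e = step e′ (reach-snoc r e)

reach-trans : ∀ {F a b c} → Reach F a b → Reach F b c → Reach F a c
reach-trans here       r′ = r′
reach-trans (step e r) r′ = step e (reach-trans r r′)

reach-sym : ∀ {F a b} → Reach F a b → Reach F b a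
reach-sym here       = here
reach-sym {F} (step e r) = reach-snoc (reach-sym r) (edge-sym F e)

hom-reach : ∀ {F G} (f : V F → V G) → IsHom F G f → ∀ {a b} → Reach F a b → Reach G (f a) (f b)
hom-reach f f-hom here                 = here
hom-reach f f-hom (step {a} {b} e r) = step (f-hom a b e) (hom-reach f f-hom r)

subgraph-refl : (F : Graph) → SubgraphEmb F F
subgraph-refl F = record { emb = id ; inj = id ; hom = λ _ _ e → e }

subgraph-trans : ∀ {A B C} → SubgraphEmb A B → SubgraphEmb B C → SubgraphEmb A C
subgraph-trans s t = record
  { emb = T.emb ∘ S.emb
  ; inj = S.inj ∘ T.inj
  ; hom = λ a b e → T.hom _ _ (S.hom a b e)
  }
  where
    module S = SubgraphEmb s
    module T = SubgraphEmb t

_[_] : (F : Graph) → (V F → Bool) → Graph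
F [ K ] = record
  { n      = countF (n F) K
  ; adj    = λ i j → adj F (select (n F) K i) (select (n F) K j)
  ; sym    = λ i j → Graph.sym F _ _
  ; irrefl = λ i → irrefl F _
  }

induced-subgraph : (F : Graph) (K : V F → Bool) → SubgraphEmb (F [ K ]) F
induced-subgraph F K = record
  { emb = select (n F) K
  ; inj = select-injective (n F) K
  ; hom = λ _ _ e → e
  }

-- G ─ w only computes once n G is a successor; this record exposes it for any G.
record VertexDeletion (G : Graph) (w : V G) : Set where
  field
    inject           : V (G ─ w) → V G
    inject-injective : Injective _≡_ _≡_ inject
    inject-induced   : ∀ x y → adj (G ─ w) x y ≡ adj G (inject x) (inject y)
    inject-≢         : ∀ x → inject x ≢ w
    project          : ∀ y → y ≢ w → V (G ─ w)
    inject-project   : ∀ y (y≢w : y ≢ w) → inject (project y y≢w) ≡ y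
    size             : suc (n (G ─ w)) ≡ n G

  inject-hom : IsHom (G ─ w) G inject
  inject-hom x y e = trans (sym (inject-induced x y)) e

  edge-project : ∀ {y x} (y≢w : y ≢ w) → Edge G y (inject x) → Edge (G ─ w) (project y y≢w) x
  edge-project {y} {x} y≢w e =
    trans (inject-induced _ x) (subst (λ z → Edge G z (inject x)) (sym (inject-project y y≢w)) e)

  project-edge : ∀ {y z} (y≢w : y ≢ w) (z≢w : z ≢ w) → Edge G y z →
                 Edge (G ─ w) (project y y≢w) (project z z≢w)
  project-edge {z = z} y≢w z≢w e =
    edge-project y≢w (subst (Edge G _) (sym (inject-project z z≢w)) e)

vertexDeletion : (G : Graph) (w : V G) → VertexDeletion G w
vertexDeletion record { n = suc m } w = record
  { inject           = punchIn w
  ; inject-injective = punchIn-injective w _ _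
  ; inject-induced   = λ _ _ → refl
  ; inject-≢         = punchInᵢ≢i w
  ; project          = λ y y≢w → punchOut (y≢w ∘ sym)
  ; inject-project   = λ _ _ → punchIn-punchOut _
  ; size             = refl
  }

deletion-subgraph : (G : Graph) (w : V G) → SubgraphEmb (G ─ w) G
deletion-subgraph G w = record { emb = inject ; inj = inject-injective ; hom = inject-hom }
  where open VertexDeletion (vertexDeletion G w)

avoiding-subgraph : ∀ {A F} (s : SubgraphEmb A F) (v : V F) →
  (∀ a → SubgraphEmb.emb s a ≢ v) → SubgraphEmb A (F ─ v)
avoiding-subgraph {F = F} s v avoids = record
  { emb = λ a → project (emb a) (avoids a)
  ; inj = λ {a} {b} eq → inj (begin
      emb a                          ≡⟨ inject-project (emb a) (avoids a) ⟨
      inject (project (emb a) _)     ≡⟨ cong inject eq ⟩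
      inject (project (emb b) _)     ≡⟨ inject-project (emb b) (avoids b) ⟩
      emb b                          ∎)
  ; hom = λ a b e → project-edge (avoids a) (avoids b) (hom a b e)
  }
  where
    open SubgraphEmb s
    open VertexDeletion (vertexDeletion F v)
    open ≡-Reasoning

deletion-subgraph-mono : ∀ {F′ F a v} (s : SubgraphEmb F′ F) → SubgraphEmb.emb s a ≡ v →
  SubgraphEmb (F′ ─ a) (F ─ v)
deletion-subgraph-mono {F′} {a = a} s refl =
  avoiding-subgraph (subgraph-trans (deletion-subgraph F′ a) s) _
    (λ x eq → inject-≢ x (SubgraphEmb.inj s eq))
  where open VertexDeletion (vertexDeletion F′ a)

walk-avoiding : ∀ (F : Graph) (a : V F) {x b} →
  let open VertexDeletion (vertexDeletion F a) in
  (b′ : V (F ─ a)) → inject b′ ≡ b → Reach F x b →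
  (∃[ x′ ] inject x′ ≡ x × Reach (F ─ a) x′ b′) ⊎
  (∃[ c ] Edge F a (inject c) × Reach (F ─ a) c b′)
walk-avoiding F a b′ eq here = inj₁ (b′ , eq , here)
walk-avoiding F a {x} b′ eq (step e r) with walk-avoiding F a b′ eq r
... | inj₂ c                = inj₂ c
... | inj₁ (y′ , refl , r′) with x ≟ a
...   | yes refl = inj₂ (y′ , e , r′)
...   | no x≢a   = inj₁ (project x x≢a , inject-project x x≢a , step (edge-project x≢a e) r′)
  where open VertexDeletion (vertexDeletion F a)

reach?-of-size : ∀ k (F : Graph) → n F ≡ k → (a b : V F) → Dec (Reach F a b)
reach?-of-size zero    F n≡k a b = ⊥-elim (¬Fin0 (subst Fin n≡k a))
reach?-of-size (suc k) F n≡k a b with b ≟ a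
... | yes refl = yes here
... | no b≢a   = map′ via-neighbour first-step
      (any? λ c → (adj F a (inject c) Bool.≟ true)
                  ×-dec reach?-of-size k (F ─ a) (suc-injective (trans size n≡k)) c b′)
  where
    open VertexDeletion (vertexDeletion F a)
    b′ = project b b≢a

    via-neighbour : ∃[ c ] Edge F a (inject c) × Reach (F ─ a) c b′ → Reach F a b
    via-neighbour (c , e , r) =
      step e (subst (Reach F (inject c)) (inject-project b b≢a) (hom-reach inject inject-hom r))

    first-step : Reach F a b → ∃[ c ] Edge F a (inject c) × Reach (F ─ a) c b′
    first-step r with walk-avoiding F a b′ (inject-project b b≢a) r
    ... | inj₁ (x , x≡a , _) = ⊥-elim (inject-≢ x x≡a)
    ... | inj₂ c             = c

reach? : (F : Graph) (a b : V F) → Dec (Reach F a b)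
reach? F = reach?-of-size (n F) F refl

connected? : (F : Graph) → Dec (Connected F)
connected? F = (0 <? n F) ×-dec all? (λ a → all? (reach? F a))

reachable : (F : Graph) → V F → V F → Bool
reachable F v u = does (reach? F v u)

reachable-closed : ∀ F v {a b} → reachable F v a ≡ true → Edge F a b → reachable F v b ≡ true
reachable-closed F v {a} {b} va e =
  dec-true (reach? F v b) (reach-snoc (does-true⇒ (reach? F v a) va) e)

component : (F : Graph) → V F → Graph
component F v = F [ reachable F v ]

component-isComponent : (F : Graph) (v : V F) → IsComponent F v (component F v)
component-isComponent F v = record
  { emb     = select (n F) (reachable F v)
  ; inj     = select-injective (n F) (reachable F v)
  ; induced = λ _ _ → refl
  ; inComp  = λ i → does-true⇒ (reach? F v _) (select-true (n F) (reachable F v) i)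
  ; onto    = λ u r → select-onto (n F) (reachable F v) u (dec-true (reach? F v u) r)
  }

module _ {F : Graph} {v : V F} {H : Graph} (h : IsComponent F v H) where
  open IsComponent h

  component-subgraph : SubgraphEmb H F
  component-subgraph = record
    { emb = emb
    ; inj = inj
    ; hom = λ i j e → trans (sym (induced i j)) e
    }

  component-reach : ∀ {x y} → Reach F x y → ∀ i j → emb i ≡ x → emb j ≡ y → Reach H i j
  component-reach here i j ei ej = subst (Reach H i) (inj (trans ei (sym ej))) here
  component-reach (step {b = c} e r) i j refl ej with onto c (reach-snoc (inComp i) e)
  ... | k , refl = step (trans (induced i k) e) (component-reach r k j refl ej)

  component-connected : Connected H
  component-connected =
    m<n⇒0<n (toℕ<n (proj₁ (onto v here))) ,
    λ i j → component-reach (reach-trans (reach-sym (inComp i)) (inComp j)) i j refl refl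

  connected-in-component : ∀ {F′} (s : SubgraphEmb F′ F) →
    (∀ a → Reach F v (SubgraphEmb.emb s a)) → SubgraphEmb F′ H
  connected-in-component s reach = record
    { emb = λ a → proj₁ (lift a)
    ; inj = λ {a} {b} eq → S.inj (trans (sym (proj₂ (lift a))) (trans (cong emb eq) (proj₂ (lift b))))
    ; hom = λ a b e →
        trans (induced _ _) (subst₂ (Edge F) (sym (proj₂ (lift a))) (sym (proj₂ (lift b))) (S.hom a b e))
    }
    where
      module S = SubgraphEmb s
      lift : ∀ a → ∃[ i ] emb i ≡ S.emb a
      lift a = onto (S.emb a) (reach a)

edLe-suc : ∀ {C d F} → EdLe C d F → EdLe C (suc d) F
edLe-suc (inClass x)          = inClass x
edLe-suc (connected c v e)    = connected c v (edLe-suc e)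
edLe-suc (disconnected ¬c ed) = disconnected ¬c (λ v H h → edLe-suc (ed v H h))

module _ {C : Class} (C-subgraph-closed : SubgraphClosed C) where
  mutual
    edLe-subgraph : ∀ {d F′ F} → SubgraphEmb F′ F → EdLe C d F → EdLe C d F′
    edLe-subgraph {F′ = F′} s ed with connected? F′
    ... | yes c  = edLe-connected-subgraph s c ed
    ... | no ¬c = disconnected ¬c λ v H h →
      edLe-connected-subgraph (subgraph-trans (component-subgraph h) s) (component-connected h) ed

    edLe-connected-subgraph : ∀ {d F′ F} → SubgraphEmb F′ F → Connected F′ → EdLe C d F → EdLe C d F′
    edLe-connected-subgraph s c (inClass x) = inClass (C-subgraph-closed _ _ s x)
    edLe-connected-subgraph s c (connected _ v ed) with any? (λ a → SubgraphEmb.emb s a ≟ v)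
    ... | yes (a , a↦v) = connected c a (edLe-subgraph (deletion-subgraph-mono s a↦v) ed)
    ... | no v∉s        = edLe-suc (edLe-subgraph (avoiding-subgraph s v (λ a eq → v∉s (a , eq))) ed)
    edLe-connected-subgraph {F = F} s c (disconnected _ ed) =
      edLe-subgraph (connected-in-component h s reach) (ed v (component F v) h)
      where
        open SubgraphEmb s
        a₀ = fromℕ< (proj₁ c)
        v  = emb a₀
        h  = component-isComponent F v
        reach : ∀ a → Reach F v (emb a)
        reach a = hom-reach emb hom (proj₂ c a₀ a)

-- Fibre parities of homomorphisms whose vertices are all odd or even

record IsOddEvenHom (F G : Graph) (φ : V F → V G) : Set where
  field
    hom       : IsHom F G φ
    oddOrEven : ∀ a → IsOddVertex F G φ a ⊎ IsEvenVertex F G φ a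
    oddDec    : ∀ a → Dec (IsOddVertex F G φ a)

  oddIn : V F → V G → Bool
  oddIn a u = if fibreEq F G φ (φ a) u then does (oddDec a) else false

  oddsIn : V G → ℕ
  oddsIn u = countF (n F) (λ a → oddIn a u)

open IsOddEvenHom using (oddIn; oddsIn)

oddomorphism⇒weak : ∀ {F G φ} → IsOddomorphism F G φ → IsWeakOddomorphism F G φ
oddomorphism⇒weak {F} O = record
  { hom = IsOddomorphism.hom O ; F' = F ; ι = subgraph-refl F ; odd = O }

isOddEvenHom : ∀ {F G φ} → IsOddomorphism F G φ → IsOddEvenHom F G φ
isOddEvenHom O = record { hom = hom ; oddOrEven = oddOrEven ; oddDec = oddDec }
  where open IsOddomorphism O

module _ {F G : Graph} {φ : V F → V G} (P : IsOddEvenHom F G φ) where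
  open IsOddEvenHom P using (hom; oddOrEven; oddDec)

  oddDec-parity : ∀ {a v} → Edge G (φ a) v → does (oddDec a) ≡ parity (nbrsIn F G φ a v)
  oddDec-parity {a} {v} e with oddDec a | oddOrEven a
  ... | yes o | _       = sym (parity-odd (nbrsIn F G φ a v) (o v e))
  ... | no ¬o | inj₁ o  = ⊥-elim (¬o o)
  ... | no _  | inj₂ ev = sym (parity-even (nbrsIn F G φ a v) (ev v e))

  crossingTerm : V G → V G → V F → V F → Bool
  crossingTerm u v a b =
    if fibreEq F G φ (φ a) u then (if adj F a b then fibreEq F G φ (φ b) v else false) else false

  crossing : V G → V G → Bool
  crossing u v = xorSum λ a → xorSum λ b → crossingTerm u v a b

  crossing-sym : ∀ u v → crossing u v ≡ crossing v u
  crossing-sym u v = trans (∑-comm (crossingTerm u v)) (sum-cong-≗ λ b → sum-cong-≗ λ a →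
    trans (if-if-swap (fibreEq F G φ (φ a) u) (adj F a b) (fibreEq F G φ (φ b) v))
          (cong (λ e → if fibreEq F G φ (φ b) v then (if e then fibreEq F G φ (φ a) u else false) else false)
                (Graph.sym F a b)))

  parity-oddsIn≡crossing : ∀ {u v} → Edge G u v → parity (oddsIn P u) ≡ crossing u v
  parity-oddsIn≡crossing {u} {v} e = trans (parity-countF (n F) _) (sum-cong-≗ fibre-term)
    where
      fibre-term : ∀ a → oddIn P a u ≡ xorSum (crossingTerm u v a)
      fibre-term a with φ a ≟ u
      ... | yes refl = trans (oddDec-parity e) (parity-countF (n F) _)
      ... | no _     = sym (sum-replicate-zero (n F))

  parity-oddsIn-edge : ∀ {u v} → Edge G u v → parity (oddsIn P u) ≡ parity (oddsIn P v)
  parity-oddsIn-edge {u} {v} e = begin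
    parity (oddsIn P u)   ≡⟨ parity-oddsIn≡crossing e ⟩
    crossing u v          ≡⟨ crossing-sym u v ⟩
    crossing v u          ≡⟨ parity-oddsIn≡crossing (edge-sym G e) ⟨
    parity (oddsIn P v)   ∎
    where open ≡-Reasoning

  parity-oddsIn-reach : ∀ {u v} → Reach G u v → parity (oddsIn P u) ≡ parity (oddsIn P v)
  parity-oddsIn-reach here       = refl
  parity-oddsIn-reach (step e r) = trans (parity-oddsIn-edge e) (parity-oddsIn-reach r)

  toOddomorphism : (∀ u → Odd (oddsIn P u)) → IsOddomorphism F G φ
  toOddomorphism odd = record
    { hom = hom ; oddOrEven = oddOrEven ; oddDec = oddDec ; fibreOdd = odd }

  oddomorphism-from-parity : Connected G → ∀ u → parity (oddsIn P u) ≡ true → IsOddomorphism F G φ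
  oddomorphism-from-parity (_ , reach) u odd-at-u = toOddomorphism λ x →
    parity⇒odd (oddsIn P x) (trans (sym (parity-oddsIn-reach (reach u x))) odd-at-u)

-- φ restricted to the vertices K of F, with values in the induced subgraph e(G′) of G.
-- The hypotheses ensure that neighbour counts into fibres over e(G′), and hence
-- oddness, are unchanged by the restriction.
module Restriction {F G : Graph} {φ : V F → V G} (P : IsOddEvenHom F G φ)
  {G′ : Graph} (e : V G′ → V G) (e-injective : Injective _≡_ _≡_ e)
  (e-induced : ∀ x y → adj G′ x y ≡ adj G (e x) (e y))
  (K : V F → Bool) (K-lift : ∀ {a} → K a ≡ true → ∃[ x ] e x ≡ φ a)
  (K-closed : ∀ {a b x} → K a ≡ true → Edge F a b → φ b ≡ e x → K b ≡ true)
  (K-odd : ∀ {a} → K a ≡ true →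
           (∀ x → Edge G (φ a) (e x) → Odd (nbrsIn F G φ a (e x))) → IsOddVertex F G φ a)
  where

  open IsOddEvenHom P using (hom; oddOrEven; oddDec)

  F′ : Graph
  F′ = F [ K ]

  private
    s : V F′ → V F
    s = select (n F) K

    s∈K : ∀ i → K (s i) ≡ true
    s∈K = select-true (n F) K

  ψ : V F′ → V G′
  ψ i = proj₁ (K-lift (s∈K i))

  private
    e∘ψ : ∀ i → e (ψ i) ≡ φ (s i)
    e∘ψ i = proj₂ (K-lift (s∈K i))

    fibreEq-ψ : ∀ i x → fibreEq F′ G′ ψ (ψ i) x ≡ fibreEq F G φ (φ (s i)) (e x)
    fibreEq-ψ i x = trans (does-⇔ (mk⇔ (cong e) e-injective) (ψ i ≟ x) (e (ψ i) ≟ e x))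
                          (cong (λ y → does (y ≟ e x)) (e∘ψ i))

    edge-ψ⇒ : ∀ {i x} → Edge G′ (ψ i) x → Edge G (φ (s i)) (e x)
    edge-ψ⇒ {i} {x} eg = subst (λ y → Edge G y (e x)) (e∘ψ i) (trans (sym (e-induced (ψ i) x)) eg)

    edge-ψ⇐ : ∀ {i x} → Edge G (φ (s i)) (e x) → Edge G′ (ψ i) x
    edge-ψ⇐ {i} {x} eg = trans (e-induced (ψ i) x) (subst (λ y → Edge G y (e x)) (sym (e∘ψ i)) eg)

  nbrsIn-restriction : ∀ i x → nbrsIn F′ G′ ψ i x ≡ nbrsIn F G φ (s i) (e x)
  nbrsIn-restriction i x = begin
    countF (n F′) (λ b → if adj F (s i) (s b) then fibreEq F′ G′ ψ (ψ b) x else false)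
      ≡⟨ countF-cong (n F′) (λ b → cong (λ y → if adj F (s i) (s b) then y else false) (fibreEq-ψ b x)) ⟩
    countF (n F′) (Q ∘ s)
      ≡⟨ countF-select (n F) K Q ⟩
    countF (n F) (λ c → K c ∧ Q c)
      ≡⟨ countF-cong (n F) (λ c → ∧-implied (Q⇒K c)) ⟩
    countF (n F) Q
      ∎
    where
      open ≡-Reasoning
      Q : V F → Bool
      Q c = if adj F (s i) c then fibreEq F G φ (φ c) (e x) else false
      Q⇒K : ∀ c → Q c ≡ true → K c ≡ true
      Q⇒K c q with if-true q
      ... | ec , φc≡ex = K-closed (s∈K i) ec (does-true⇒ (φ c ≟ e x) φc≡ex)

  private
    odd⇒ : ∀ i → IsOddVertex F G φ (s i) → IsOddVertex F′ G′ ψ i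
    odd⇒ i o x eg = subst Odd (sym (nbrsIn-restriction i x)) (o (e x) (edge-ψ⇒ eg))

    odd⇐ : ∀ i → IsOddVertex F′ G′ ψ i → IsOddVertex F G φ (s i)
    odd⇐ i o = K-odd (s∈K i) λ x eg → subst Odd (nbrsIn-restriction i x) (o x (edge-ψ⇐ eg))

    even⇒ : ∀ i → IsEvenVertex F G φ (s i) → IsEvenVertex F′ G′ ψ i
    even⇒ i ev x eg = subst Even (sym (nbrsIn-restriction i x)) (ev (e x) (edge-ψ⇒ eg))

  isOddEvenHom′ : IsOddEvenHom F′ G′ ψ
  isOddEvenHom′ = record
    { hom       = λ i j eF → trans (e-induced (ψ i) (ψ j))
                    (subst₂ (Edge G) (sym (e∘ψ i)) (sym (e∘ψ j)) (hom (s i) (s j) eF))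
    ; oddOrEven = λ i → Sum.map (odd⇒ i) (even⇒ i) (oddOrEven (s i))
    ; oddDec    = λ i → map′ (odd⇒ i) (odd⇐ i) (oddDec (s i))
    }

  oddsIn-restriction : ∀ x → oddsIn isOddEvenHom′ x ≡ countF (n F) (λ a → K a ∧ oddIn P a (e x))
  oddsIn-restriction x =
    trans (countF-cong (n F′) λ i →
            cong (λ y → if y then does (oddDec (s i)) else false) (fibreEq-ψ i x))
          (countF-select (n F) K (λ a → oddIn P a (e x)))

  isOddomorphism : (∀ {a x} → oddIn P a (e x) ≡ true → K a ≡ true) →
                   (∀ x → Odd (oddsIn P (e x))) → IsOddomorphism F′ G′ ψ
  isOddomorphism odd⇒K odd = toOddomorphism isOddEvenHom′ λ x →
    subst Odd (sym (trans (oddsIn-restriction x) (countF-cong (n F) λ _ → ∧-implied odd⇒K))) (odd x)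

record OddomorphicSubgraph (F G : Graph) : Set where
  field
    F′  : Graph
    ι   : SubgraphEmb F′ F
    ψ   : V F′ → V G
    odd : IsOddomorphism F′ G ψ

oddomorphicSubgraph-widen : ∀ {F₀ F G} → SubgraphEmb F F₀ → OddomorphicSubgraph F G → OddomorphicSubgraph F₀ G
oddomorphicSubgraph-widen s S = record { F′ = F′ ; ι = subgraph-trans ι s ; ψ = ψ ; odd = odd }
  where open OddomorphicSubgraph S

restrict-to-component : ∀ {F G φ v H} → IsOddomorphism F G φ → IsComponent G v H → OddomorphicSubgraph F H
restrict-to-component {F} {G} {φ} {v} O h = record
  { F′ = R.F′ ; ι = induced-subgraph F K ; ψ = R.ψ ; odd = R.isOddomorphism odd⇒K (fibreOdd ∘ emb) }
  where
    open IsComponent h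
    open IsOddomorphism O using (fibreOdd)
    P = isOddEvenHom O

    over? : ∀ a → Dec (∃[ x ] emb x ≡ φ a)
    over? a = any? λ x → emb x ≟ φ a

    K : V F → Bool
    K a = does (over? a)

    K-closed : ∀ {a b x} → K a ≡ true → Edge F a b → φ b ≡ emb x → K b ≡ true
    K-closed {b = b} {x} _ _ φb≡ex = dec-true (over? b) (x , sym φb≡ex)

    -- every neighbour in G of a vertex of H lies in H
    K-odd : ∀ {a} → K a ≡ true →
            (∀ x → Edge G (φ a) (emb x) → Odd (nbrsIn F G φ a (emb x))) → IsOddVertex F G φ a
    K-odd {a} ka odd-in-H y eG with does-true⇒ (over? a) ka
    ... | i , eᵢ with onto y (reach-snoc (subst (Reach G v) eᵢ (inComp i)) eG)
    ...   | x , refl = odd-in-H x eG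

    odd⇒K : ∀ {a x} → oddIn P a (emb x) ≡ true → K a ≡ true
    odd⇒K {a} {x} q = dec-true (over? a) (x , sym (does-true⇒ (φ a ≟ emb x) (proj₁ (if-true q))))

    module R = Restriction P emb inj induced K (does-true⇒ (over? _)) K-closed K-odd

-- Besides the fibre over w = φ v, the even vertices whose image has no neighbour
-- other than w are dropped: in G - w they would be vacuously odd.
restrict-to-deletion : ∀ {F G φ} → IsOddomorphism F G φ → (v : V F) → OddomorphicSubgraph (F ─ v) (G ─ φ v)
restrict-to-deletion {F} {G} {φ} O v = record
  { F′ = R.F′
  ; ι = avoiding-subgraph (induced-subgraph F K) v
          (λ i eq → proj₁ (kept (select-true (n F) K i)) (cong φ eq))
  ; ψ = R.ψ
  ; odd = R.isOddomorphism odd⇒K (fibreOdd ∘ inject)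
  }
  where
    open IsOddomorphism O
    open VertexDeletion (vertexDeletion G (φ v))
    P = isOddEvenHom O
    w = φ v

    Kept : V F → Set
    Kept a = φ a ≢ w × (IsOddVertex F G φ a ⊎ ∃[ x ] Edge G (φ a) (inject x))

    Kept? : ∀ a → Dec (Kept a)
    Kept? a = ¬? (φ a ≟ w) ×-dec (oddDec a ⊎-dec any? λ x → adj G (φ a) (inject x) Bool.≟ true)

    K : V F → Bool
    K a = does (Kept? a)

    kept : ∀ {a} → K a ≡ true → Kept a
    kept = does-true⇒ (Kept? _)

    K-lift : ∀ {a} → K a ≡ true → ∃[ x ] inject x ≡ φ a
    K-lift {a} ka = project (φ a) (proj₁ (kept ka)) , inject-project (φ a) (proj₁ (kept ka))

    K-closed : ∀ {a b x} → K a ≡ true → Edge F a b → φ b ≡ inject x → K b ≡ true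
    K-closed {a} {b} {x} ka eF φb≡x = dec-true (Kept? b)
      ( (λ φb≡w → inject-≢ x (trans (sym φb≡x) φb≡w))
      , inj₂ (project (φ a) a≢w
             , subst (Edge G (φ b)) (sym (inject-project (φ a) a≢w)) (edge-sym G (hom a b eF))))
      where a≢w = proj₁ (kept ka)

    K-odd : ∀ {a} → K a ≡ true →
            (∀ x → Edge G (φ a) (inject x) → Odd (nbrsIn F G φ a (inject x))) → IsOddVertex F G φ a
    K-odd {a} ka odd-off-w with proj₂ (kept ka) | oddOrEven a
    ... | inj₁ o        | _       = o
    ... | inj₂ _        | inj₁ o  = o
    ... | inj₂ (x , eG) | inj₂ ev = ⊥-elim (odd-even {nbrsIn F G φ a (inject x)} (odd-off-w x eG) (ev (inject x) eG))

    odd⇒K : ∀ {a x} → oddIn P a (inject x) ≡ true → K a ≡ true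
    odd⇒K {a} {x} q with if-true q
    ... | φa≡x , o = dec-true (Kept? a)
      ( (λ φa≡w → inject-≢ x (trans (sym (does-true⇒ (φ a ≟ inject x) φa≡x)) φa≡w))
      , inj₁ (does-true⇒ (oddDec a) o))

    module R = Restriction P inject inject-injective inject-induced K K-lift K-closed K-odd

-- A connected subgraph oddomorphic to a connected target

module _ {F G : Graph} {φ : V F → V G} (O : IsOddomorphism F G φ) (cG : Connected G)
         (K : V F → Bool) (K-closed : ∀ {a b} → K a ≡ true → Edge F a b → K b ≡ true) where

  private
    P = isOddEvenHom O
    K̄ = not ∘ K

    K̄-closed : ∀ {a b} → K̄ a ≡ true → Edge F a b → K̄ b ≡ true
    K̄-closed {a} {b} k̄a eF with K b in kb
    ... | false = refl
    ... | true with () ← trans (sym (K-closed kb (edge-sym F eF))) (Bool.not-injective k̄a)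

    module Part (L : V F → Bool) (L-closed : ∀ {a b} → L a ≡ true → Edge F a b → L b ≡ true) =
      Restriction P {G} id id (λ _ _ → refl) L (λ {a} _ → φ a , refl) (λ la eF _ → L-closed la eF) (λ _ o → o)
    module R = Part K K-closed
    module R̄ = Part K̄ K̄-closed

    parity-split : ∀ x → parity (oddsIn R.isOddEvenHom′ x) xor parity (oddsIn R̄.isOddEvenHom′ x) ≡ true
    parity-split x = begin
      parity (oddsIn R.isOddEvenHom′ x) xor parity (oddsIn R̄.isOddEvenHom′ x)
        ≡⟨ parity-+ (oddsIn R.isOddEvenHom′ x) (oddsIn R̄.isOddEvenHom′ x) ⟨
      parity (oddsIn R.isOddEvenHom′ x + oddsIn R̄.isOddEvenHom′ x)
        ≡⟨ cong parity (cong₂ _+_ (R.oddsIn-restriction x) (R̄.oddsIn-restriction x)) ⟩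
      parity (countF (n F) (λ a → K a ∧ oddIn P a x) + countF (n F) (λ a → K̄ a ∧ oddIn P a x))
        ≡⟨ cong parity (countF-split (n F) K (λ a → oddIn P a x)) ⟨
      parity (oddsIn P x)
        ≡⟨ parity-odd (oddsIn P x) (IsOddomorphism.fibreOdd O x) ⟩
      true
        ∎
      where open ≡-Reasoning

    u₀ = fromℕ< (proj₁ cG)

  oddomorphic-side : IsOddomorphism (F [ K ]) G (φ ∘ select (n F) K)
                   ⊎ IsOddomorphism (F [ K̄ ]) G (φ ∘ select (n F) K̄)
  oddomorphic-side with parity (oddsIn R.isOddEvenHom′ u₀) in p
  ... | true  = inj₁ (oddomorphism-from-parity R.isOddEvenHom′ cG u₀ p)
  ... | false = inj₂ (oddomorphism-from-parity R̄.isOddEvenHom′ cG u₀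
                  (subst (λ b → b xor parity (oddsIn R̄.isOddEvenHom′ u₀) ≡ true) p (parity-split u₀)))

oddomorphism-connected-part : ∀ {F G φ} → Acc _<_ (n F) → Connected G → IsOddomorphism F G φ →
  Σ[ S ∈ OddomorphicSubgraph F G ] Connected (OddomorphicSubgraph.F′ S)
oddomorphism-connected-part {F} (acc smaller) cG O =
  [ (λ O₁ → record { F′ = component F a ; ι = induced-subgraph F (reachable F a) ; ψ = _ ; odd = O₁ }
          , component-connected (component-isComponent F a))
  , (λ O₂ → let S , cS = oddomorphism-connected-part (smaller fewer) cG O₂
            in oddomorphicSubgraph-widen (induced-subgraph F (not ∘ reachable F a)) S , cS)
  ]′ (oddomorphic-side O cG (reachable F a) (reachable-closed F a))
  where
    a = odd-countF⇒Fin (n F) _ (IsOddomorphism.fibreOdd O (fromℕ< (proj₁ cG)))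
    fewer : countF (n F) (not ∘ reachable F a) < n F
    fewer = countF-< (n F) _ a (cong not (dec-true (reach? F a a) here))

oddomorphicSubgraph-connected-part : ∀ {F G} → Connected G → OddomorphicSubgraph F G →
  Σ[ S ∈ OddomorphicSubgraph F G ] Connected (OddomorphicSubgraph.F′ S)
oddomorphicSubgraph-connected-part cG S =
  let S₀ , cF₀ = oddomorphism-connected-part (<-wellFounded _) cG odd
  in oddomorphicSubgraph-widen ι S₀ , cF₀
  where open OddomorphicSubgraph S

-- Transfer of the elimination distance along oddomorphisms

module _ {C : Class} (C-subgraph-closed : SubgraphClosed C) (C-closed : ClosedUnderWeakOddomorphisms C) where

  mutual
    edLe-oddomorphic : ∀ d {F G} → EdLe C d F → OddomorphicSubgraph F G → EdLe C d G
    edLe-oddomorphic d {G = G} ed S with connected? G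
    ... | yes cG = edLe-oddomorphic-connected d cG ed S
    ... | no ¬cG = disconnected ¬cG λ v H h →
      edLe-oddomorphic-connected d (component-connected h) ed
        (oddomorphicSubgraph-widen ι (restrict-to-component odd h))
      where open OddomorphicSubgraph S

    edLe-oddomorphic-connected : ∀ d {F G} → Connected G → EdLe C d F → OddomorphicSubgraph F G → EdLe C d G
    edLe-oddomorphic-connected d cG ed S =
      let S₀ , cF₀ = oddomorphicSubgraph-connected-part cG S
          open OddomorphicSubgraph S₀
      in edLe-oddomorphism-between d cF₀ cG (edLe-subgraph C-subgraph-closed ι ed) odd

    edLe-oddomorphism-between : ∀ d {F G φ} → Connected F → Connected G →
      EdLe C d F → IsOddomorphism F G φ → EdLe C d G
    edLe-oddomorphism-between d cF cG (inClass x) O = inClass (C-closed _ _ _ x (oddomorphism⇒weak O))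
    edLe-oddomorphism-between (suc d) {φ = φ} cF cG (connected _ v ed) O =
      connected cG (φ v) (edLe-oddomorphic d ed (restrict-to-deletion O v))
    edLe-oddomorphism-between d cF cG (disconnected ¬cF _) O = ⊥-elim (¬cF cF)

theorem3p6 : (C : Class) (d : ℕ) → SubgraphClosed C
    → ClosedUnderWeakOddomorphisms C
    → ClosedUnderWeakOddomorphisms (EdLe C d)
theorem3p6 C d C-subgraph-closed C-closed F G φ ed W =
  edLe-oddomorphic C-subgraph-closed C-closed d ed record { F′ = F' ; ι = ι ; ψ = _ ; odd = odd }
  where open IsWeakOddomorphism W
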